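{- There exists a deterministic weak-probe local computation algorithm for weak $2$-coloring that, on every $n$-vertex input graph, answers a query to a vertex $v$ using at most $\log^* n + 2d_v + O(1)$ weak probes, where $d_v$ is the degree of $v$.
   Context: The input is a simple undirected graph $G=(V,E)$ with $n$ vertices with distinct IDs, represented as an array: cell $(v,0)$ holds the degree $d_v$ of $v$ and cell $(v,j)$, $1\le j\le d_v$, holds the ID of the neighbor at $v$'s $j$-th port. A weak probe specifies a cell $(v,j)$ and returns its content. A deterministic local computation algorithm receives a query vertex, makes probes, and returns that vertex's color; the answers to all queries must be consistent with a single valid solution. A weak $2$-coloring is a map $col:V\to\{0,1\}$ such that every non-isolated vertex has a neighbor of a different color. -}

module Defs where

open import Data.Nat using (ℕ; zero; suc; _+_; _≤_; _<_; _≤?_; _<?_)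
open import Data.Nat.Logarithm using (⌊log₂_⌋)
open import Data.Fin using (Fin; toℕ; fromℕ<)
open import Data.Bool using (Bool)
open import Data.Maybe using (Maybe; just; nothing)
open import Data.Product using (Σ; _×_; _,_; ∃-syntax)
open import Function.Definitions using (Injective)
open import Relation.Binary.PropositionalEquality using (_≡_; _≢_)
open import Relation.Nullary using (yes; no)

-- Input graph on n vertices; vertex IDs are 0..n-1 (Fin n).
-- deg v = d_v (cell (v,0)); nbr v j = neighbour at port j+1 (cell (v,j+1)).
record Graph (n : ℕ) : Set where
  field
    deg : Fin n → ℕ
    nbr : (v : Fin n) → Fin (deg v) → Fin n

open Graph public

record Simple {n : ℕ} (G : Graph n) : Set where
  field
    loopless  : ∀ v j → nbr G v j ≢ v
    noMulti   : ∀ v → Injective _≡_ _≡_ (nbr G v)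
    symmetric : ∀ v j → ∃[ k ] nbr G (nbr G v j) k ≡ v

cell : {n : ℕ} → Graph n → Fin n → ℕ → Maybe ℕ
cell G v zero = just (deg G v)
cell G v (suc j) with j <? deg G v
... | yes p = just (toℕ (nbr G v (fromℕ< p)))
... | no _  = nothing

-- A deterministic adaptive weak-probe algorithm for one query: a decision tree.
-- Each internal node probes cell (v , j) and branches on the returned content.
data Tree (n : ℕ) : Set where
  leaf  : Bool → Tree n
  probe : Fin n → ℕ → (Maybe ℕ → Tree n) → Tree n

run : {n : ℕ} → Graph n → Tree n → Bool × ℕ
run G (leaf b) = b , 0
run G (probe v j k) with run G (k (cell G v j))
... | b , c = b , suc c

LCA : Set
LCA = (n : ℕ) → Fin n → Tree n

colourOf : LCA → {n : ℕ} → Graph n → Fin n → Bool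
colourOf A {n} G v = Data.Product.proj₁ (run G (A n v))
  where import Data.Product

probesOf : LCA → {n : ℕ} → Graph n → Fin n → ℕ
probesOf A {n} G v = Data.Product.proj₂ (run G (A n v))
  where import Data.Product

WeakTwoColouring : {n : ℕ} → Graph n → (Fin n → Bool) → Set
WeakTwoColouring G col = ∀ v → deg G v ≢ 0 → ∃[ j ] col (nbr G v j) ≢ col v

logStarFuel : ℕ → ℕ → ℕ
logStarFuel zero    x = 0
logStarFuel (suc f) x with x ≤? 1
... | yes _ = 0
... | no  _ = suc (logStarFuel f ⌊log₂ x ⌋)

log* : ℕ → ℕ
log* n = logStarFuel n n

module Submission where

open import Defs
open import Data.Nat using (ℕ; _+_; _*_; _≤_)
open import Data.Product using (Σ; _×_; ∃-syntax)

open import Data.Bool using (Bool; true; false; not; _xor_; _∨_; if_then_else_; T)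
open import Data.Bool.Properties using (∨-zeroʳ; not-¬)
open import Data.Empty using (⊥-elim)
open import Data.Fin using (Fin; toℕ; fromℕ<)
import Data.Fin.Properties as Fin
open import Data.Fin.Properties using (toℕ<n; fromℕ<-toℕ)
open import Data.Maybe using (Maybe; just; nothing; fromMaybe)
open import Data.Nat using (zero; suc; _∸_; _<_; _<ᵇ_; _<?_; _≤?_; _^_; z≤n; s≤s; ⌊_/2⌋; parity)
open import Data.Nat.GeneralisedArithmetic using (iterate)
open import Data.Nat.Logarithm using (⌊log₂_⌋; ⌊log₂⌋-mono-≤; ⌊log₂⌊n/2⌋⌋≡⌊log₂n⌋∸1; ⌊log₂[2*b]⌋≡1+⌊log₂b⌋; ⌊log₂[2^n]⌋≡n)
open import Data.Nat.Properties
open import Data.Nat.Tactic.RingSolver using (solve-∀)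
open import Data.Parity.Base using (Parity; 0ℙ; 1ℙ)
import Data.Parity.Properties as ℙ
open import Data.Product using (proj₁; proj₂; _,_)
open import Data.Product.Properties using (,-injectiveˡ; ,-injectiveʳ)
open import Data.Sum using (_⊎_; inj₁; inj₂)
import Data.Sum as Sum
open import Data.Unit using (tt)
open import Function using (_∘_)
open import Relation.Nullary using (¬_; Dec; yes; no; does)
open import Relation.Nullary.Decidable using (dec-true)
open import Relation.Binary.PropositionalEquality

-- Every vertex x points to the neighbour at its first port, parent x (one
-- probe), which turns the graph into a pseudoforest. A query v reads its
-- degree, spends two probes per port to learn whether v has a child, and
-- follows log* n + 8 parent pointers to obtain the IDs on its upward path.
-- Along such a path, log* n + 1 Cole–Vishkin rounds yield a proper colouring
-- by 0 … 5, from which we read a bit (direction of the current monotone run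
-- xor the parity of its length) that never stays constant on three
-- consecutive vertices. A vertex with a child takes the bit of its own path,
-- a childless one the opposite of its parent's bit; looking at v, a child of
-- v and the parent of v shows that every non-isolated vertex has a neighbour
-- of the other colour.

parity-half-injective : ∀ a b → parity a ≡ parity b → ⌊ a /2⌋ ≡ ⌊ b /2⌋ → a ≡ b
parity-half-injective zero          zero          _  _  = refl
parity-half-injective (suc zero)    (suc zero)    _  _  = refl
parity-half-injective (suc (suc a)) (suc (suc b)) pe he =
  cong (λ c → suc (suc c)) (parity-half-injective a b pe (suc-injective he))
parity-half-injective zero          (suc zero)    () _
parity-half-injective (suc zero)    zero          () _
parity-half-injective zero          (suc (suc b)) _  ()
parity-half-injective (suc (suc a)) zero          _  ()
parity-half-injective (suc zero)    (suc (suc b)) _  ()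
parity-half-injective (suc (suc a)) (suc zero)    _  ()

double : ℕ → ℕ
double zero    = zero
double (suc k) = suc (suc (double k))

bitValue : Parity → ℕ
bitValue 0ℙ = 0
bitValue 1ℙ = 1

encode : ℕ × Parity → ℕ
encode (k , p) = double k + bitValue p

parity-encode : ∀ k p → parity (encode (k , p)) ≡ p
parity-encode zero    0ℙ = refl
parity-encode zero    1ℙ = refl
parity-encode (suc k) p  = parity-encode k p

half-encode : ∀ k p → ⌊ encode (k , p) /2⌋ ≡ k
half-encode zero    0ℙ = refl
half-encode zero    1ℙ = refl
half-encode (suc k) p  = cong suc (half-encode k p)

encode-injective : ∀ q r → encode q ≡ encode r → q ≡ r
encode-injective (k , p) (m , p′) e = cong₂ _,_
  (trans (sym (half-encode k p)) (trans (cong ⌊_/2⌋ e) (half-encode m p′)))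
  (trans (sym (parity-encode k p)) (trans (cong parity e) (parity-encode m p′)))

double-mono : ∀ {k m} → k ≤ m → double k ≤ double m
double-mono z≤n     = z≤n
double-mono (s≤s p) = s≤s (s≤s (double-mono p))

encode-bound : ∀ {k m} p → k ≤ m → encode (k , p) ≤ suc (double m)
encode-bound {k} 0ℙ k≤m = ≤-trans (≤-reflexive (+-identityʳ (double k))) (m≤n⇒m≤1+n (double-mono k≤m))
encode-bound {k} 1ℙ k≤m = ≤-trans (≤-reflexive (+-comm (double k) 1)) (s≤s (double-mono k≤m))

scanStep : Parity → Parity → ℕ × Parity → ℕ × Parity
scanStep x y r = if does (x ℙ.≟ y) then (suc (proj₁ r) , proj₂ r) else (0 , x)

-- lowestDiff F a b = (i , i-th bit of a) for the lowest position i in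
-- which a and b differ, provided a, b ≤ F (F is the recursion fuel).
lowestDiff : ℕ → ℕ → ℕ → ℕ × Parity
lowestDiff zero    a b = 0 , parity a
lowestDiff (suc F) a b = scanStep (parity a) (parity b) (lowestDiff F ⌊ a /2⌋ ⌊ b /2⌋)

half-≤ : ∀ {a F} → a ≤ suc F → ⌊ a /2⌋ ≤ F
half-≤ {a} {F} a≤ = ≤-pred (≤-trans (s≤s (⌊n/2⌋-mono a≤)) (⌊n/2⌋<n F))

halves-differ : ∀ {a b} → parity a ≡ parity b → a ≢ b → ⌊ a /2⌋ ≢ ⌊ b /2⌋
halves-differ pe a≢b he = a≢b (parity-half-injective _ _ pe he)

-- The Cole–Vishkin observation: for a ≠ b ≠ c the pairs
-- (position, bit) computed for (a , b) and for (b , c) differ.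
lowestDiff-distinct : ∀ F {a b c} → a ≤ F → b ≤ F → c ≤ F → a ≢ b → b ≢ c →
                      lowestDiff F a b ≢ lowestDiff F b c
lowestDiff-distinct zero {a} {b} a≤ b≤ _ a≢b _ _ = a≢b (trans (n≤0⇒n≡0 a≤) (sym (n≤0⇒n≡0 b≤)))
lowestDiff-distinct (suc F) {a} {b} {c} a≤ b≤ c≤ a≢b b≢c
  with parity a ℙ.≟ parity b | parity b ℙ.≟ parity c
... | no pa≢pb | no _   = λ e → pa≢pb (,-injectiveʳ e)
... | no _     | yes _  = λ ()
... | yes _    | no _   = λ ()
... | yes pab  | yes pbc = λ e → lowestDiff-distinct F (half-≤ a≤) (half-≤ b≤) (half-≤ c≤)
  (halves-differ pab a≢b) (halves-differ pbc b≢c)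
  (cong₂ _,_ (suc-injective (,-injectiveˡ e)) (,-injectiveʳ e))

log-half : ∀ X → ⌊ X /2⌋ ≢ 0 → suc ⌊log₂ ⌊ X /2⌋ ⌋ ≤ ⌊log₂ X ⌋
log-half zero          h≢0 = ⊥-elim (h≢0 refl)
log-half (suc zero)    h≢0 = ⊥-elim (h≢0 refl)
log-half X@(suc (suc _)) _ =
  ≤-trans (≤-reflexive (cong suc (⌊log₂⌊n/2⌋⌋≡⌊log₂n⌋∸1 X)))
          (pred-below (⌊log₂⌋-mono-≤ {2} {X} (s≤s (s≤s z≤n))))
  where
  pred-below : ∀ {m} → 1 ≤ m → suc (m ∸ 1) ≤ m
  pred-below {suc m} _ = ≤-refl

lowestDiff-position : ∀ F {X a b} → a ≤ X → b ≤ X → a ≢ b → proj₁ (lowestDiff F a b) ≤ ⌊log₂ X ⌋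
lowestDiff-position zero _ _ _ = z≤n
lowestDiff-position (suc F) {X} {a} {b} a≤ b≤ a≢b with parity a ℙ.≟ parity b
... | no _    = z≤n
... | yes pab = ≤-trans (s≤s (lowestDiff-position F ha≤ hb≤ ha≢hb)) (log-half X hX≢0)
  where
  ha≤ : ⌊ a /2⌋ ≤ ⌊ X /2⌋
  ha≤ = ⌊n/2⌋-mono a≤
  hb≤ : ⌊ b /2⌋ ≤ ⌊ X /2⌋
  hb≤ = ⌊n/2⌋-mono b≤
  ha≢hb : ⌊ a /2⌋ ≢ ⌊ b /2⌋
  ha≢hb = halves-differ pab a≢b
  hX≢0 : ⌊ X /2⌋ ≢ 0
  hX≢0 hX≡0 = ha≢hb (trans (n≤0⇒n≡0 (subst (_ ≤_) hX≡0 ha≤)) (sym (n≤0⇒n≡0 (subst (_ ≤_) hX≡0 hb≤))))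

-- Cole–Vishkin colour reduction along a sequence

-- Sequences of colours, read along a path: index 0 is the start.
Seq : Set
Seq = ℕ → ℕ

tail : Seq → Seq
tail s i = s (suc i)

Proper : Seq → Set
Proper s = ∀ i → s i ≢ s (suc i)

BoundedBy : ℕ → Seq → Set
BoundedBy X s = ∀ i → s i ≤ X

AgreeUpTo : ℕ → Seq → Seq → Set
AgreeUpTo N s s′ = ∀ i → i ≤ N → s i ≡ s′ i

agreeUpTo-tail : ∀ {N s s′} → AgreeUpTo (suc N) s s′ → AgreeUpTo N (tail s) (tail s′)
agreeUpTo-tail agree i i≤N = agree (suc i) (s≤s i≤N)

agreeUpTo-weaken : ∀ {N s s′} → AgreeUpTo (suc N) s s′ → AgreeUpTo N s s′
agreeUpTo-weaken agree i i≤N = agree i (m≤n⇒m≤1+n i≤N)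

palette : ℕ → ℕ
palette X = suc (double ⌊log₂ X ⌋)

cvColour : ℕ → ℕ → ℕ → ℕ
cvColour X a b = encode (lowestDiff X a b)

cvColour-bound : ∀ {X a b} → a ≤ X → b ≤ X → a ≢ b → cvColour X a b ≤ palette X
cvColour-bound {X} {a} {b} a≤ b≤ a≢b =
  encode-bound (proj₂ (lowestDiff X a b)) (lowestDiff-position X a≤ b≤ a≢b)

cvColour-distinct : ∀ {X a b c} → a ≤ X → b ≤ X → c ≤ X → a ≢ b → b ≢ c →
                    cvColour X a b ≢ cvColour X b c
cvColour-distinct {X} a≤ b≤ c≤ a≢b b≢c e =
  lowestDiff-distinct X a≤ b≤ c≤ a≢b b≢c (encode-injective _ _ e)

cvRounds : ℕ → ℕ → Seq → Seq
cvRounds zero    X s = s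
cvRounds (suc k) X s = cvRounds k (palette X) (λ i → cvColour X (s i) (s (suc i)))

cvRounds-proper : ∀ k {X s} → BoundedBy X s → Proper s →
                  BoundedBy (iterate palette X k) (cvRounds k X s) × Proper (cvRounds k X s)
cvRounds-proper zero    bounded proper = bounded , proper
cvRounds-proper (suc k) bounded proper = cvRounds-proper k
  (λ i → cvColour-bound (bounded i) (bounded (suc i)) (proper i))
  (λ i → cvColour-distinct (bounded i) (bounded (suc i)) (bounded (suc (suc i)))
                           (proper i) (proper (suc i)))

cvRounds-local : ∀ k N {X s s′} → AgreeUpTo (k + N) s s′ →
                 AgreeUpTo N (cvRounds k X s) (cvRounds k X s′)
cvRounds-local zero    N agree = agree
cvRounds-local (suc k) N {X} agree = cvRounds-local k N λ i i≤ →
  cong₂ (cvColour X) (agreeUpTo-weaken agree i i≤) (agree (suc i) (s≤s i≤))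

cvRounds-tail : ∀ k X s i → cvRounds k X (tail s) i ≡ cvRounds k X s (suc i)
cvRounds-tail zero    X s i = refl
cvRounds-tail (suc k) X s i = cvRounds-tail k (palette X) (λ j → cvColour X (s j) (s (suc j))) i

-- log* n + 1 rounds bring the palette down to six colours

palette-mono : ∀ {X Y} → X ≤ Y → palette X ≤ palette Y
palette-mono X≤Y = s≤s (double-mono (⌊log₂⌋-mono-≤ X≤Y))

-- palette 7 = 5, so colours ≤ 7 are reduced to the six colours 0 … 5.
palette-small : ∀ {X} → X ≤ 7 → palette X ≤ 5
palette-small {X} X≤7 = palette-mono {X} {7} X≤7

double-is-2* : ∀ k → double k ≡ 2 * k
double-is-2* zero    = refl
double-is-2* (suc k) = cong suc (trans (cong suc (double-is-2* k)) (sym (+-suc k (k + 0))))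

n≤double : ∀ n → n ≤ double n
n≤double zero    = z≤n
n≤double (suc n) = s≤s (m≤n⇒m≤1+n (n≤double n))

1+n≤2^n : ∀ n → suc n ≤ 2 ^ n
1+n≤2^n zero    = s≤s z≤n
1+n≤2^n (suc n) = ≤-trans (+-mono-≤ (m^n>0 2 n) (1+n≤2^n n)) (≤-reflexive (cong (2 ^ n +_) (sym (+-identityʳ (2 ^ n)))))

-- ⌊log₂ z⌋ < z, in the form needed to consume one unit of fuel.
log-≤-pred : ∀ {z f} → z ≤ suc f → ⌊log₂ z ⌋ ≤ f
log-≤-pred {zero}  _   = z≤n
log-≤-pred {suc w} z≤ = ≤-trans (⌊log₂⌋-mono-≤ (1+n≤2^n w))
                          (≤-trans (≤-reflexive (⌊log₂[2^n]⌋≡n w)) (≤-pred z≤))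

log-2z+5 : ∀ z → 2 ≤ z → ⌊log₂ (double z + 5) ⌋ ≤ 2 + ⌊log₂ z ⌋
log-2z+5 (suc zero)              (s≤s ())
log-2z+5 (suc (suc zero))        _ = ≤-refl
log-2z+5 z@(suc (suc (suc _))) _ = ≤-trans (⌊log₂⌋-mono-≤ 2z+5≤4z) (≤-reflexive log4z)
  where
  2z+5≤4z : double z + 5 ≤ 2 * (2 * z)
  2z+5≤4z = begin
    double z + 5      ≡⟨ cong (_+ 5) (double-is-2* z) ⟩
    2 * z + 5         ≤⟨ +-monoʳ-≤ (2 * z) (≤-trans (n≤1+n 5) (*-monoʳ-≤ 2 {3} {z} (s≤s (s≤s (s≤s z≤n))))) ⟩
    2 * z + 2 * z     ≡⟨ cong (2 * z +_) (sym (+-identityʳ (2 * z))) ⟩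
    2 * (2 * z)       ∎
    where open ≤-Reasoning
  log4z : ⌊log₂ (2 * (2 * z)) ⌋ ≡ 2 + ⌊log₂ z ⌋
  log4z = trans (⌊log₂[2*b]⌋≡1+⌊log₂b⌋ (2 * z)) (cong suc (⌊log₂[2*b]⌋≡1+⌊log₂b⌋ z))

palette-shrinks : ∀ {z m} → 2 ≤ z → m ≤ double z + 5 → palette m ≤ double ⌊log₂ z ⌋ + 5
palette-shrinks {z} 2≤z m≤ =
  ≤-trans (palette-mono m≤)
    (≤-trans (s≤s (double-mono (log-2z+5 z 2≤z))) (≤-reflexive (+-comm 5 (double ⌊log₂ z ⌋))))

logStar-rounds : ∀ f z m → z ≤ f → m ≤ double z + 5 → iterate palette m (suc (logStarFuel f z)) ≤ 5
logStar-rounds zero z m z≤0 m≤ =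
  palette-small (≤-trans m≤ (+-monoˡ-≤ 5 (double-mono {z} {1} (≤-trans z≤0 z≤n))))
logStar-rounds (suc f) z m z≤ m≤ with z ≤? 1
... | yes z≤1 = palette-small (≤-trans m≤ (+-monoˡ-≤ 5 (double-mono z≤1)))
... | no  z≰1 = logStar-rounds f ⌊log₂ z ⌋ (palette m) (log-≤-pred z≤) (palette-shrinks (≰⇒> z≰1) m≤)

rounds-suffice : ∀ n → iterate palette n (suc (log* n)) ≤ 5
rounds-suffice n = logStar-rounds n n n ≤-refl (≤-trans (n≤double n) (m≤m+n (double n) 5))

-- From six colours to one bit that changes within any three steps

ascends : Seq → ℕ → Bool
ascends t i = t i <ᵇ t (suc i)

ascends-true : ∀ t i → ascends t i ≡ true → t i < t (suc i)
ascends-true t i up = <ᵇ⇒< (t i) (t (suc i)) (subst T (sym up) tt)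

ascends-false : ∀ t i → ascends t i ≡ false → t (suc i) ≤ t i
ascends-false t i down = ≮⇒≥ λ lt → subst T down (<⇒<ᵇ lt)

runStep : Bool → Bool → ℕ → ℕ
runStep true  true  r = suc r
runStep false false r = suc r
runStep true  false r = 0
runStep false true  r = 0

runStep-suc : ∀ x y m {r} → runStep x y m ≡ suc r → x ≡ y × m ≡ r
runStep-suc true  true  m refl = refl , refl
runStep-suc false false m refl = refl , refl

runStep-zero : ∀ x y m → runStep x y m ≡ 0 → x ≢ y
runStep-zero true  false m _ = λ ()
runStep-zero false true  m _ = λ ()

runStep-≤ : ∀ x y {m k} → m ≤ k → runStep x y m ≤ suc k
runStep-≤ true  true  m≤k = s≤s m≤k
runStep-≤ false false m≤k = s≤s m≤k
runStep-≤ true  false _   = z≤n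
runStep-≤ false true  _   = z≤n

runStep-respects : ∀ x y {m m′ k} → runStep x y m < suc k → (m < k → m ≡ m′) →
                   runStep x y m ≡ runStep x y m′
runStep-respects true  true  lt same = cong suc (same (<-pred lt))
runStep-respects false false lt same = cong suc (same (<-pred lt))
runStep-respects true  false _  _    = refl
runStep-respects false true  _  _    = refl

-- runLength f t = number of steps after step 0 that go in the same
-- direction as step 0, counted with fuel f (so it is at most f).
runLength : ℕ → Seq → ℕ
runLength zero    t = 0
runLength (suc f) t = runStep (ascends t 0) (ascends t 1) (runLength f (tail t))

runLength-≤ : ∀ f t → runLength f t ≤ f
runLength-≤ zero    t = z≤n
runLength-≤ (suc f) t = runStep-≤ (ascends t 0) (ascends t 1) (runLength-≤ f (tail t))

runLength-saturates : ∀ f t → runLength (suc f) t < suc f → runLength (suc f) t ≡ runLength f t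
runLength-saturates zero    t lt = n<1⇒n≡0 lt
runLength-saturates (suc f) t lt =
  runStep-respects (ascends t 0) (ascends t 1) lt (runLength-saturates f (tail t))

runLength-full : ∀ f t → runLength f t ≡ f → ∀ i → i ≤ f → ascends t i ≡ ascends t 0
runLength-full f       t e zero    _        = refl
runLength-full (suc f) t e (suc i) (s≤s i≤f) =
  trans (runLength-full f (tail t) (proj₂ same) i i≤f) (sym (proj₁ same))
  where
  same = runStep-suc (ascends t 0) (ascends t 1) (runLength f (tail t)) e

climb : ∀ t k → (∀ i → i < k → ascends t i ≡ true) → k + t 0 ≤ t k
climb t zero    up = ≤-refl
climb t (suc k) up = ≤-trans (s≤s (climb t k (λ i i<k → up i (m<n⇒m<1+n i<k))))
                             (ascends-true t k (up k ≤-refl))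

descend : ∀ t k → Proper t → (∀ i → i < k → ascends t i ≡ false) → k + t k ≤ t 0
descend t zero    proper down = ≤-refl
descend t (suc k) proper down = ≤-trans (≤-reflexive (sym (+-suc k (t (suc k)))))
  (≤-trans (+-monoʳ-≤ k step) (descend t k proper (λ i i<k → down i (m<n⇒m<1+n i<k))))
  where
  step : suc (t (suc k)) ≤ t k
  step = ≤∧≢⇒< (ascends-false t k (down k ≤-refl)) (λ e → proper k (sym e))

no-long-monotone-run : ∀ t → BoundedBy 5 t → Proper t → ¬ (∀ i → i ≤ 5 → ascends t i ≡ ascends t 0)
no-long-monotone-run t bounded proper same with ascends t 0
... | true  = <-irrefl refl (≤-trans (m≤m+n 6 (t 0)) (≤-trans (climb t 6 λ i i<6 → same i (≤-pred i<6)) (bounded 6)))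
... | false = <-irrefl refl (≤-trans (m≤m+n 6 (t 6)) (≤-trans (descend t 6 proper λ i i<6 → same i (≤-pred i<6)) (bounded 0)))

runLength-stable : ∀ t → BoundedBy 5 t → Proper t → runLength 5 t ≡ runLength 4 t
runLength-stable t bounded proper = runLength-saturates 4 t
  (≤∧≢⇒< (runLength-≤ 5 t) λ full → no-long-monotone-run t bounded proper (runLength-full 5 t full))

alternate : ℕ → Bool
alternate zero    = false
alternate (suc k) = not (alternate k)

weakBit : Seq → Bool
weakBit t = alternate (runLength 5 t) xor ascends t 0

not-xor-≢ : ∀ x d → not x xor d ≢ x xor d
not-xor-≢ true  true  ()
not-xor-≢ true  false ()
not-xor-≢ false true  ()
not-xor-≢ false false ()

-- Inside a monotone run the run length drops by one per step, so the bit flips.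
weakBit-flips-in-run : ∀ t → BoundedBy 5 t → Proper t → ∀ {r} → runLength 5 t ≡ suc r →
                       weakBit t ≢ weakBit (tail t)
weakBit-flips-in-run t bounded proper {r} run≡ same-bit = not-xor-≢ (alternate r) (ascends t 0) (begin
  not (alternate r) xor ascends t 0        ≡⟨ cong (λ m → alternate m xor ascends t 0) (sym run≡) ⟩
  weakBit t                                ≡⟨ same-bit ⟩
  weakBit (tail t)                         ≡⟨ cong₂ (λ m d → alternate m xor d) tail-run (sym same-dir) ⟩
  alternate r xor ascends t 0              ∎)
  where
  open ≡-Reasoning
  step = runStep-suc (ascends t 0) (ascends t 1) (runLength 4 (tail t)) run≡
  same-dir : ascends t 0 ≡ ascends t 1
  same-dir = proj₁ step
  tail-run : runLength 5 (tail t) ≡ r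
  tail-run = trans (runLength-stable (tail t) (bounded ∘ suc) (proper ∘ suc)) (proj₂ step)

-- Between two runs of length zero the direction changes, so the bit flips.
weakBit-flips-at-turn : ∀ t → runLength 5 t ≡ 0 → runLength 5 (tail t) ≡ 0 → weakBit t ≢ weakBit (tail t)
weakBit-flips-at-turn t run₀ run₁ same-bit =
  runStep-zero (ascends t 0) (ascends t 1) (runLength 4 (tail t)) run₀ (begin
    ascends t 0        ≡⟨ cong (λ m → alternate m xor ascends t 0) (sym run₀) ⟩
    weakBit t          ≡⟨ same-bit ⟩
    weakBit (tail t)   ≡⟨ cong (λ m → alternate m xor ascends t 1) run₁ ⟩
    ascends t 1        ∎)
  where open ≡-Reasoning

weakBit-no-triple : ∀ t → BoundedBy 5 t → Proper t →
                    weakBit t ≢ weakBit (tail t) ⊎ weakBit (tail t) ≢ weakBit (tail (tail t))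
weakBit-no-triple t bounded proper = by-run-lengths (runLength 5 t) refl (runLength 5 (tail t)) refl
  where
  by-run-lengths : ∀ m → runLength 5 t ≡ m → ∀ m′ → runLength 5 (tail t) ≡ m′ →
                   weakBit t ≢ weakBit (tail t) ⊎ weakBit (tail t) ≢ weakBit (tail (tail t))
  by-run-lengths (suc r) run₀ _       _    = inj₁ (weakBit-flips-in-run t bounded proper run₀)
  by-run-lengths zero    _    (suc r) run₁ = inj₂ (weakBit-flips-in-run (tail t) (bounded ∘ suc) (proper ∘ suc) run₁)
  by-run-lengths zero    run₀ zero    run₁ = inj₁ (weakBit-flips-at-turn t run₀ run₁)

runLength-local : ∀ f {t t′} → AgreeUpTo (suc f) t t′ → runLength f t ≡ runLength f t′
runLength-local zero    agree = refl
runLength-local (suc f) agree = cong₃ runStep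
  (cong₂ _<ᵇ_ (agree 0 z≤n) (agree 1 (s≤s z≤n)))
  (cong₂ _<ᵇ_ (agree 1 (s≤s z≤n)) (agree 2 (s≤s (s≤s z≤n))))
  (runLength-local f (agreeUpTo-tail agree))
  where
  cong₃ : ∀ {A B C D : Set} (h : A → B → C → D) {a a′ b b′ c c′} →
          a ≡ a′ → b ≡ b′ → c ≡ c′ → h a b c ≡ h a′ b′ c′
  cong₃ h refl refl refl = refl

weakBit-local : ∀ {t t′} → AgreeUpTo 6 t t′ → weakBit t ≡ weakBit t′
weakBit-local agree = cong₂ (λ m d → alternate m xor d)
  (runLength-local 5 agree) (cong₂ _<ᵇ_ (agree 0 z≤n) (agree 1 (s≤s z≤n)))

rounds : ℕ → ℕ
rounds n = suc (log* n)

-- The rest of the development uses pathBit only through its two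
-- properties below, so its definition is kept opaque (this also keeps
-- the type checker from unfolding the Cole–Vishkin rounds).
opaque
  pathBit : ℕ → Seq → Bool
  pathBit n s = weakBit (cvRounds (rounds n) n s)

  pathBit-local : ∀ n {s s′} → AgreeUpTo (rounds n + 6) s s′ → pathBit n s ≡ pathBit n s′
  pathBit-local n agree = weakBit-local (cvRounds-local (rounds n) 6 {n} agree)

  pathBit-no-triple : ∀ n s → BoundedBy n s → Proper s →
                      pathBit n s ≢ pathBit n (tail s) ⊎ pathBit n (tail s) ≢ pathBit n (tail (tail s))
  pathBit-no-triple n s bounded proper =
    Sum.map (λ τ₀≢τ₁ e → τ₀≢τ₁ (trans e shift₁))
            (λ τ₁≢τ₂ e → τ₁≢τ₂ (trans (sym shift₁) (trans e shift₂)))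
            (weakBit-no-triple τ (λ i → ≤-trans (proj₁ invariant i) (rounds-suffice n)) (proj₂ invariant))
    where
    R : ℕ
    R = rounds n
    τ : Seq
    τ = cvRounds R n s
    invariant : BoundedBy (iterate palette n R) τ × Proper τ
    invariant = cvRounds-proper R bounded proper
    shift₁ : pathBit n (tail s) ≡ weakBit (tail τ)
    shift₁ = weakBit-local (λ i _ → cvRounds-tail R n s i)
    shift₂ : pathBit n (tail (tail s)) ≡ weakBit (tail (tail τ))
    shift₂ = weakBit-local (λ i _ → trans (cvRounds-tail R n (tail s) i) (cvRounds-tail R n s (suc i)))

colourRule : ℕ → Bool → Seq → Bool
colourRule n found s = if found then pathBit n s else not (pathBit n (tail s))

iterate-suc : ∀ {A : Set} (f : A → A) x i → iterate f x (suc i) ≡ f (iterate f x i)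
iterate-suc f x zero    = refl
iterate-suc f x (suc i) = iterate-suc f (f x) i

does-true : ∀ {P : Set} (P? : Dec P) → does P? ≡ true → P
does-true (yes p) _ = p

-- A probed cell read as a vertex ID; if it holds no ID we fall back to a default vertex.
asVertex : ∀ {n} → Fin n → Maybe ℕ → Fin n
asVertex fallback nothing = fallback
asVertex {n} fallback (just x) with x <? n
... | yes x<n = fromℕ< x<n
... | no  _   = fallback

asVertex-id : ∀ {n} (fallback y : Fin n) → asVertex fallback (just (toℕ y)) ≡ y
asVertex-id {n} fallback y with toℕ y <? n
... | yes y<n = fromℕ<-toℕ y y<n
... | no  y≮n = ⊥-elim (y≮n (toℕ<n y))

module Reading {n : ℕ} (G : Graph n) where

  readVertex : Fin n → ℕ → Fin n
  readVertex v j = asVertex v (cell G v j)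

  readVertex-port : ∀ v k (k<d : k < deg G v) → readVertex v (suc k) ≡ nbr G v (fromℕ< k<d)
  readVertex-port v k k<d with k <? deg G v
  ... | yes _   = asVertex-id v _
  ... | no  k≮d = ⊥-elim (k≮d k<d)

  -- Every vertex points to the neighbour at its first port (isolated vertices to themselves).
  -- These pointers form a pseudoforest, in which we look for children and ancestors.
  parent : Fin n → Fin n
  parent x = readVertex x 1

  firstPort : ∀ x → deg G x ≢ 0 → Fin (deg G x)
  firstPort x d≢0 = fromℕ< (n≢0⇒n>0 d≢0)

  parent-firstPort : ∀ x (d≢0 : deg G x ≢ 0) → parent x ≡ nbr G x (firstPort x d≢0)
  parent-firstPort x d≢0 = readVertex-port x 0 (n≢0⇒n>0 d≢0)

  path : Fin n → Seq
  path x i = toℕ (iterate parent x i)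

  path-bounded : ∀ x → BoundedBy n (path x)
  path-bounded x i = <⇒≤ (toℕ<n (iterate parent x i))

  isChildAt : Fin n → ℕ → Bool
  isChildAt v k = does (parent (readVertex v (suc k)) Fin.≟ v)

  hasChildAmong : Fin n → ℕ → Bool
  hasChildAmong v zero    = false
  hasChildAmong v (suc k) = isChildAt v k ∨ hasChildAmong v k

  hasChild : Fin n → Bool
  hasChild v = hasChildAmong v (deg G v)

  hasChildAmong-complete : ∀ v d k → k < d → (k<deg : k < deg G v) → parent (nbr G v (fromℕ< k<deg)) ≡ v →
                           hasChildAmong v d ≡ true
  hasChildAmong-complete v (suc d) k k<d k<deg child with k ≟ d
  ... | yes refl = cong (_∨ hasChildAmong v k)
                        (dec-true (_ Fin.≟ v) (trans (cong parent (readVertex-port v k k<deg)) child))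
  ... | no  k≢d  = trans (cong (isChildAt v d ∨_) (hasChildAmong-complete v d k (≤∧≢⇒< (≤-pred k<d) k≢d) k<deg child))
                         (∨-zeroʳ (isChildAt v d))

  hasChild-complete : ∀ v (j : Fin (deg G v)) → parent (nbr G v j) ≡ v → hasChild v ≡ true
  hasChild-complete v j child = hasChildAmong-complete v (deg G v) (toℕ j) (toℕ<n j) (toℕ<n j)
    (trans (cong (parent ∘ nbr G v) (fromℕ<-toℕ j (toℕ<n j))) child)

  hasChildAmong-sound : ∀ v d → d ≤ deg G v → hasChildAmong v d ≡ true →
                        Σ (Fin (deg G v)) λ j → parent (nbr G v j) ≡ v
  hasChildAmong-sound v (suc d) d<deg found with isChildAt v d in here
  ... | true  = fromℕ< d<deg , trans (cong parent (sym (readVertex-port v d d<deg))) (does-true (_ Fin.≟ v) here)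
  ... | false = hasChildAmong-sound v d (<⇒≤ d<deg) found

  hasChild-sound : ∀ v → hasChild v ≡ true → Σ (Fin (deg G v)) λ j → parent (nbr G v j) ≡ v
  hasChild-sound v = hasChildAmong-sound v (deg G v) ≤-refl

  colour : Fin n → Bool
  colour v = colourRule n (hasChild v) (path v)

  colour-with-child : ∀ v → hasChild v ≡ true → colour v ≡ pathBit n (path v)
  colour-with-child v found = cong (λ b → colourRule n b (path v)) found

  colour-childless : ∀ v → hasChild v ≡ false → colour v ≡ not (pathBit n (path (parent v)))
  colour-childless v none = cong (λ b → colourRule n b (path v)) none

  module _ (simple : Simple G) where
    open Simple simple

    neighbour-not-isolated : ∀ v (j : Fin (deg G v)) → deg G (nbr G v j) ≢ 0
    neighbour-not-isolated v j d≡0 with symmetric v j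
    ... | k , _ = 0≢fin (sym d≡0) k
      where
      0≢fin : ∀ {m} → 0 ≡ m → ¬ Fin m
      0≢fin refl ()

    ancestor-not-isolated : ∀ i x → deg G x ≢ 0 → deg G (iterate parent x i) ≢ 0
    ancestor-not-isolated zero    x d≢0 = d≢0
    ancestor-not-isolated (suc i) x d≢0 = ancestor-not-isolated i (parent x)
      (subst (λ y → deg G y ≢ 0) (sym (parent-firstPort x d≢0)) (neighbour-not-isolated x (firstPort x d≢0)))

    parent-differs : ∀ x → deg G x ≢ 0 → parent x ≢ x
    parent-differs x d≢0 e = loopless x (firstPort x d≢0) (trans (sym (parent-firstPort x d≢0)) e)

    path-proper : ∀ x → deg G x ≢ 0 → Proper (path x)
    path-proper x d≢0 i e = parent-differs (iterate parent x i) (ancestor-not-isolated i x d≢0)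
      (sym (Fin.toℕ-injective (trans e (cong toℕ (iterate-suc parent x i)))))

    parent-hasChild : ∀ v → deg G v ≢ 0 → hasChild (parent v) ≡ true
    parent-hasChild v d≢0 with symmetric v (firstPort v d≢0)
    ... | k , back = subst (λ u → hasChild u ≡ true) (sym first)
                           (hasChild-complete _ k (trans (cong parent back) first))
      where first = parent-firstPort v d≢0

    colour-parent : ∀ v → deg G v ≢ 0 → colour (parent v) ≡ pathBit n (path (parent v))
    colour-parent v d≢0 = colour-with-child (parent v) (parent-hasChild v d≢0)

    -- Some neighbour of every non-isolated vertex v gets a different colour:
    -- if v is childless, its parent; if v has a childless child w, w; and if
    -- v has a child w with a child, w or the parent of v, since the bits of
    -- w, v and parent v along the path from w are not all equal.
    colour-weak : WeakTwoColouring G colour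
    colour-weak v d≢0 = by-child (hasChild v) refl
      where
      j₀ = firstPort v d≢0
      nbr-j₀ : nbr G v j₀ ≡ parent v
      nbr-j₀ = sym (parent-firstPort v d≢0)

      differs-from-parent : colour (parent v) ≢ colour v → ∃[ j ] colour (nbr G v j) ≢ colour v
      differs-from-parent ne = j₀ , λ same → ne (trans (cong colour (sym nbr-j₀)) same)

      by-child : ∀ b → hasChild v ≡ b → ∃[ j ] colour (nbr G v j) ≢ colour v
      by-child false none = differs-from-parent λ same →
        not-¬ refl (trans (sym (colour-parent v d≢0)) (trans same (colour-childless v none)))
      by-child true  found = by-grandchild (hasChild w) refl
        where
        child = hasChild-sound v found
        j = proj₁ child
        w = nbr G v j
        w↑ : path (parent w) ≡ path v
        w↑ = cong path (proj₂ child)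
        colour-v : colour v ≡ pathBit n (path v)
        colour-v = colour-with-child v found
        bit-v : pathBit n (tail (path w)) ≡ colour v
        bit-v = trans (cong (pathBit n) w↑) (sym colour-v)

        by-grandchild : ∀ b → hasChild w ≡ b → ∃[ j ] colour (nbr G v j) ≢ colour v
        by-grandchild false none = j , λ same →
          not-¬ refl (trans (sym colour-v) (trans (sym same)
                              (trans (colour-childless w none) (cong (not ∘ pathBit n) w↑))))
        by-grandchild true found-w with pathBit-no-triple n (path w) (path-bounded w)
                                          (path-proper w (neighbour-not-isolated v j))
        ... | inj₁ w≢v  = j , λ same → w≢v (trans bit-w (trans same (sym bit-v)))
          where
          bit-w : pathBit n (path w) ≡ colour w
          bit-w = sym (colour-with-child w found-w)
        ... | inj₂ v≢pv = differs-from-parent λ same → v≢pv (trans bit-v (trans (sym same) (sym bit-pv)))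
          where
          bit-pv : pathBit n (tail (tail (path w))) ≡ colour (parent v)
          bit-pv = trans (cong (pathBit n ∘ path ∘ parent) (proj₂ child)) (sym (colour-parent v d≢0))

-- The algorithm as a decision tree

prepend : ℕ → Seq → Seq
prepend a s zero    = a
prepend a s (suc i) = s i

probeVertex : ∀ {n} → Fin n → ℕ → (Fin n → Tree n) → Tree n
probeVertex v j κ = probe v j (κ ∘ asVertex v)

followParents : ∀ {n} → ℕ → Fin n → (Seq → Tree n) → Tree n
followParents zero    x κ = κ (λ _ → toℕ x)
followParents (suc k) x κ = probeVertex x 1 λ p → followParents k p (κ ∘ prepend (toℕ x))

scanChildren : ∀ {n} → Fin n → ℕ → (Bool → Tree n) → Tree n
scanChildren v zero    κ = κ false
scanChildren v (suc k) κ = probeVertex v (suc k) λ w → probeVertex w 1 λ p →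
                           scanChildren v k λ found → κ (does (p Fin.≟ v) ∨ found)

-- Enough parents to compute the bit of the query vertex and of its parent.
chainLength : ℕ → ℕ
chainLength n = suc (rounds n + 6)

weakColouringLCA : LCA
weakColouringLCA n v = probe v 0 λ d → scanChildren v (fromMaybe 0 d) λ found →
                       followParents (chainLength n) v (leaf ∘ colourRule n found)

withCost : ℕ → Bool × ℕ → Bool × ℕ
withCost k r = proj₁ r , k + proj₂ r

module Running {n : ℕ} (G : Graph n) where
  open Reading G

  run-probe : ∀ v j κ → run G (probe v j κ) ≡ withCost 1 (run G (κ (cell G v j)))
  run-probe v j κ with run G (κ (cell G v j))
  ... | b , c = refl

  visited : ℕ → Fin n → Seq
  visited zero    x = λ _ → toℕ x
  visited (suc k) x = prepend (toℕ x) (visited k (parent x))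

  visited-path : ∀ k x → AgreeUpTo k (visited k x) (path x)
  visited-path zero    x zero    _         = refl
  visited-path (suc k) x zero    _         = refl
  visited-path (suc k) x (suc i) (s≤s i≤k) = visited-path k (parent x) i i≤k

  run-probeVertex : ∀ v j κ → run G (probeVertex v j κ) ≡ withCost 1 (run G (κ (readVertex v j)))
  run-probeVertex v j κ = run-probe v j (κ ∘ asVertex v)

  run-followParents : ∀ k x κ → run G (followParents k x κ) ≡ withCost k (run G (κ (visited k x)))
  run-followParents zero    x κ = refl
  run-followParents (suc k) x κ =
    trans (run-probeVertex x 1 λ p → followParents k p (κ ∘ prepend (toℕ x)))
          (cong (withCost 1) (run-followParents k (parent x) (κ ∘ prepend (toℕ x))))

  run-scanChildren : ∀ v k κ → run G (scanChildren v k κ) ≡ withCost (2 * k) (run G (κ (hasChildAmong v k)))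
  run-scanChildren v zero    κ = refl
  run-scanChildren v (suc k) κ = begin
    run G (scanChildren v (suc k) κ)                           ≡⟨ run-probeVertex v (suc k) checkPort ⟩
    withCost 1 (run G (checkPort w))                           ≡⟨ cong (withCost 1) (run-probeVertex w 1 continue) ⟩
    withCost 2 (run G (continue (parent w)))                   ≡⟨ cong (withCost 2) (run-scanChildren v k (κ ∘ (isChildAt v k ∨_))) ⟩
    withCost (2 + 2 * k) (run G (κ (hasChildAmong v (suc k)))) ≡⟨ cong (λ c → withCost c (run G (κ (hasChildAmong v (suc k))))) (sym (*-suc 2 k)) ⟩
    withCost (2 * suc k) (run G (κ (hasChildAmong v (suc k)))) ∎
    where
    open ≡-Reasoning
    w = readVertex v (suc k)
    continue : Fin n → Tree n
    continue p = scanChildren v k λ found → κ (does (p Fin.≟ v) ∨ found)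
    checkPort : Fin n → Tree n
    checkPort u = probeVertex u 1 continue

  run-weakColouringLCA : ∀ v → run G (weakColouringLCA n v) ≡
    (colourRule n (hasChild v) (visited (chainLength n) v) , suc (2 * deg G v + (chainLength n + 0)))
  run-weakColouringLCA v =
    trans (run-probe v 0 λ d → scanChildren v (fromMaybe 0 d) walk)
      (cong (withCost 1) (trans (run-scanChildren v (deg G v) walk)
        (cong (withCost (2 * deg G v)) (run-followParents (chainLength n) v (leaf ∘ colourRule n (hasChild v))))))
    where
    walk : Bool → Tree n
    walk found = followParents (chainLength n) v (leaf ∘ colourRule n found)

  -- The tree answers with the colour of the rule, since the walk sees enough of the path.
  colourOf-weakColouringLCA : ∀ v → colourOf weakColouringLCA G v ≡ colour v
  colourOf-weakColouringLCA v = trans (cong proj₁ (run-weakColouringLCA v)) (rule-local (hasChild v))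
    where
    seen = visited-path (chainLength n) v
    rule-local : ∀ found → colourRule n found (visited (chainLength n) v) ≡ colourRule n found (path v)
    rule-local true  = pathBit-local n (agreeUpTo-weaken seen)
    rule-local false = cong not (pathBit-local n (agreeUpTo-tail seen))

  -- One probe for the degree, two per port, chainLength n for the walk.
  probesOf-weakColouringLCA : ∀ v → probesOf weakColouringLCA G v ≡ log* n + 2 * deg G v + 9
  probesOf-weakColouringLCA v = trans (cong proj₂ (run-weakColouringLCA v)) (count (log* n) (deg G v))
    where
    count : ∀ L d → suc (2 * d + (suc (suc L + 6) + 0)) ≡ L + 2 * d + 9
    count = solve-∀

weakTwoColouring-cong : ∀ {n} (G : Graph n) {col col′ : Fin n → Bool} →
                        (∀ v → col v ≡ col′ v) → WeakTwoColouring G col → WeakTwoColouring G col′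
weakTwoColouring-cong G same weak v d≢0 with weak v d≢0
... | j , differs = j , λ e → differs (trans (same _) (trans e (sym (same v))))

theorem3 : ∃[ c ] Σ LCA λ A → (n : ℕ) → (G : Graph n) → Simple G → WeakTwoColouring G (colourOf A G) × (∀ v → probesOf A G v ≤ log* n + 2 * deg G v + c)
theorem3 = 9 , weakColouringLCA , λ n G simple →
  weakTwoColouring-cong G (sym ∘ Running.colourOf-weakColouringLCA G) (Reading.colour-weak G simple) ,
  λ v → ≤-reflexive (Running.probesOf-weakColouringLCA G v)
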